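{- Let $\mathcal{C}$ be the closure of the class $\{W_{2n+1}: n\ge 1\}$ of odd wheels under taking subgraphs and disjoint unions. Then $\mathcal{C}$ does not have the homomorphism preservation property: there is a first-order sentence preserved by homomorphisms over $\mathcal{C}$ that is not equivalent over $\mathcal{C}$ to any existential-positive sentence.
   Context: Graphs are finite, simple and undirected. For $n\ge 3$, the wheel $W_n$ is a cycle of length $n$ together with an apex vertex adjacent to all cycle vertices. Subgraphs are obtained by deleting vertices and/or edges. A first-order sentence $\phi$ is preserved by homomorphisms over $\mathcal{C}$ if whenever $A,B\in\mathcal{C}$, there is a homomorphism $A\to B$ and $A\models\phi$, then $B\models\phi$. $\mathcal{C}$ has the homomorphism preservation property if every first-order sentence preserved by homomorphisms over $\mathcal{C}$ is equivalent on all graphs in $\mathcal{C}$ to an existential-positive sentence. -}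

module Defs where

open import Data.Nat using (ℕ; zero; suc; _+_; _*_; _∸_; _≤_; s≤s; z≤n)
open import Data.Nat.Properties using (1+n≢n; +-monoˡ-≤; *-monoʳ-≤)
open import Data.Fin using (Fin; zero; suc; toℕ; splitAt)
open import Data.Sum using (_⊎_; inj₁; inj₂)
open import Data.Product using (Σ; _×_; _,_; proj₁; proj₂)
open import Data.Unit using (⊤; tt)
open import Data.Empty using (⊥)
open import Relation.Nullary using (¬_)
open import Relation.Binary.PropositionalEquality using (_≡_; refl; sym; trans)
open import Function.Definitions using (Injective)
open import Function.Bundles using (_⇔_)
open import Data.Vec.Functional using (Vector; []; _∷_)

record Graph : Set₁ where
  field
    size  : ℕ
    E     : Fin size → Fin size → Set
    esym  : ∀ x y → E x y → E y x
    irref : ∀ x → ¬ E x x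
open Graph public

Hom : Graph → Graph → Set
Hom A B = Σ (Fin (size A) → Fin (size B)) λ f →
            ∀ x y → E A x y → E B (f x) (f y)

Sub : Graph → Graph → Set
Sub G H = Σ (Fin (size G) → Fin (size H)) λ f →
            Injective _≡_ _≡_ f × (∀ x y → E G x y → E H (f x) (f y))

-- Wheels W_m (m ≥ 3): vertex zero is the apex, suc i is cycle vertex i.
-- Cycle edges: i — i+1, and (m-1) — 0.

CycAdj : (m : ℕ) → Fin m → Fin m → Set
CycAdj m i j = (toℕ j ≡ suc (toℕ i)) ⊎ ((toℕ i ≡ m ∸ 1) × (toℕ j ≡ 0))

private
  cyc-irr : ∀ m → 3 ≤ m → (i : Fin m) → ¬ CycAdj m i i
  cyc-irr m _ i (inj₁ p) = 1+n≢n (sym p)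
  cyc-irr (suc zero) (s≤s ()) i (inj₂ _)
  cyc-irr (suc (suc zero)) (s≤s (s≤s ())) i (inj₂ _)
  cyc-irr (suc (suc (suc m))) _ i (inj₂ (p , q)) with trans (sym p) q
  ... | ()

WE : (m : ℕ) → Fin (suc m) → Fin (suc m) → Set
WE m zero    zero    = ⊥
WE m zero    (suc _) = ⊤
WE m (suc _) zero    = ⊤
WE m (suc i) (suc j) = CycAdj m i j ⊎ CycAdj m j i

Wheel : (m : ℕ) → 3 ≤ m → Graph
Wheel m h = record
  { size  = suc m
  ; E     = WE m
  ; esym  = s
  ; irref = r
  }
  where
    s : ∀ x y → WE m x y → WE m y x
    s zero    (suc _) _ = tt
    s (suc _) zero    _ = tt
    s (suc i) (suc j) (inj₁ a) = inj₂ a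
    s (suc i) (suc j) (inj₂ a) = inj₁ a
    r : ∀ x → ¬ WE m x x
    r zero ()
    r (suc i) (inj₁ a) = cyc-irr m h i a
    r (suc i) (inj₂ a) = cyc-irr m h i a

oddWheel : (n : ℕ) → 1 ≤ n → Graph
oddWheel n h = Wheel (2 * n + 1) (+-monoˡ-≤ 1 (*-monoʳ-≤ 2 h))

UE : ∀ {m n} → (Fin m → Fin m → Set) → (Fin n → Fin n → Set) →
     Fin m ⊎ Fin n → Fin m ⊎ Fin n → Set
UE E₁ E₂ (inj₁ a) (inj₁ b) = E₁ a b
UE E₁ E₂ (inj₂ a) (inj₂ b) = E₂ a b
UE E₁ E₂ (inj₁ _) (inj₂ _) = ⊥
UE E₁ E₂ (inj₂ _) (inj₁ _) = ⊥

_⊕_ : Graph → Graph → Graph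
G ⊕ H = record
  { size  = size G + size H
  ; E     = λ x y → UE (E G) (E H) (splitAt (size G) x) (splitAt (size G) y)
  ; esym  = λ x y → s (splitAt (size G) x) (splitAt (size G) y)
  ; irref = λ x → r (splitAt (size G) x)
  }
  where
    s : ∀ u v → UE (E G) (E H) u v → UE (E G) (E H) v u
    s (inj₁ a) (inj₁ b) e = Graph.esym G a b e
    s (inj₂ a) (inj₂ b) e = Graph.esym H a b e
    r : ∀ u → ¬ UE (E G) (E H) u u
    r (inj₁ a) = irref G a
    r (inj₂ a) = irref H a

data InC : Graph → Set₁ where
  wheel : ∀ n (h : 1 ≤ n) → InC (oddWheel n h)
  sub   : ∀ {G H} → InC H → Sub G H → InC G
  union : ∀ {G H} → InC G → InC H → InC (G ⊕ H)

-- First-order logic in the language of graphs {E, =}; de Bruijn variables.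

data Fm (k : ℕ) : Set where
  true false : Fm k
  edge eq    : Fin k → Fin k → Fm k
  not        : Fm k → Fm k
  and or     : Fm k → Fm k → Fm k
  ex all     : Fm (suc k) → Fm k

Sentence : Set
Sentence = Fm 0

Sat : (G : Graph) → ∀ {k} → Fm k → Vector (Fin (size G)) k → Set
Sat G true       ρ = ⊤
Sat G false      ρ = ⊥
Sat G (edge i j) ρ = E G (ρ i) (ρ j)
Sat G (eq i j)   ρ = ρ i ≡ ρ j
Sat G (not φ)    ρ = ¬ Sat G φ ρ
Sat G (and φ ψ)  ρ = Sat G φ ρ × Sat G ψ ρ
Sat G (or φ ψ)   ρ = Sat G φ ρ ⊎ Sat G ψ ρ
Sat G (ex φ)     ρ = Σ (Fin (size G)) λ v → Sat G φ (v ∷ ρ)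
Sat G (all φ)    ρ = (v : Fin (size G)) → Sat G φ (v ∷ ρ)

_⊨_ : Graph → Sentence → Set
G ⊨ φ = Sat G φ []

data ExPos {k} : Fm k → Set where
  true  : ExPos true
  false : ExPos false
  edge  : ∀ i j → ExPos (edge i j)
  eq    : ∀ i j → ExPos (eq i j)
  and   : ∀ {φ ψ} → ExPos φ → ExPos ψ → ExPos (and φ ψ)
  or    : ∀ {φ ψ} → ExPos φ → ExPos ψ → ExPos (or φ ψ)
  ex    : ∀ {φ} → ExPos φ → ExPos (ex φ)

PreservedOver : (Graph → Set₁) → Sentence → Set₁
PreservedOver P φ = ∀ A B → P A → P B → Hom A B → A ⊨ φ → B ⊨ φ

EquivOver : (Graph → Set₁) → Sentence → Sentence → Set₁
EquivOver P φ ψ = ∀ G → P G → (G ⊨ φ) ⇔ (G ⊨ ψ)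

HPP : (Graph → Set₁) → Set₁
HPP P = ∀ φ → PreservedOver P φ → Σ Sentence λ ψ → ExPos ψ × EquivOver P φ ψ

-- A vertex is a hub if its link (the subgraph spanned by its neighbours) is nonempty
-- and every vertex of the link has two neighbours inside it; hasHub says that a hub
-- exists. In a graph of C the link of every vertex embeds into an odd cycle: for a wheel
-- the link of the apex is the rim and the link of a rim vertex lies in a triangle, and
-- subgraphs and disjoint unions inherit such embeddings. A link of minimum degree two
-- inside an odd cycle covers the whole cycle, so the link of a hub is not 2-colourable.
--
-- Preservation: let f : A → B with a a hub of A. If a neighbour x of f a had fewer than
-- two neighbours in the link of f a, the odd cycle could be cut next to the position of x
-- without cutting an edge of that link; the resulting path 2-colours the link of f a and,
-- through f, the link of a.
--
-- Non-definability: an existential-positive ψ with q existential quantifiers that holds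
-- in the wheel W of size 2q + 3 still holds after deleting the edges at a rim vertex not
-- used by the witnesses. That graph lies in C and is 3-colourable, so all its links are
-- 2-colourable and it has no hub, whereas W has one.

{-# OPTIONS --safe #-}
module Submission where

open import Defs
open import Data.Product using (Σ; _×_)
open import Relation.Nullary using (¬_)

open import Data.Fin using (Fin; zero; suc; toℕ; fromℕ; fromℕ<; inject₁; lower₁; splitAt; join; #_)
  renaming (_≤_ to _≤ᶠ_)
open import Data.Fin.Induction using (<-weakInduction-startingFrom)
open import Data.Fin.Properties
  using ( toℕ-injective; toℕ<n; toℕ-fromℕ; toℕ-inject₁; toℕ-lower₁; ≤fromℕ; join-splitAt
        ; pigeonhole; ¬∀⟶∃¬)
  renaming (suc-injective to sucᶠ-injective; <⇒≢ to <ᶠ⇒≢; _≟_ to _≟ᶠ_)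
open import Data.List using (List; []; _∷_; _++_; length; lookup)
open import Data.List.Properties using (length-++)
open import Data.List.Membership.Propositional using (_∈_; _∉_)
open import Data.List.Membership.Propositional.Properties using (∈-++⁺ˡ; ∈-++⁺ʳ)
open import Data.List.Membership.DecPropositional using () renaming (_∈?_ to member?)
open import Data.List.Relation.Unary.Any using (here; there; index)
open import Data.List.Relation.Unary.Any.Properties using (lookup-index)
open import Data.Maybe using (Maybe; just; nothing)
open import Data.Maybe.Properties using (just-injective)
open import Data.Nat using (ℕ; zero; suc; _+_; _*_; _∸_; _≤_; _<_; s≤s; z≤n; z<s; _≤?_; parity)
open import Data.Nat.Properties
  using ( ≤-refl; ≤-trans; ≤-antisym; ≤-<-trans; ≤-pred; <⇒≢; ≤∧≢⇒<; n≤1+n; m≤m+n; m≤n+m; m<n+m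
        ; +-mono-≤; +-monoˡ-≤; *-monoʳ-≤; suc-injective)
  renaming (_≟_ to _≟ℕ_)
open import Data.Parity.Base as ℙ using (Parity; 0ℙ; 1ℙ; _⁻¹)
open import Data.Parity.Properties
  using (⁻¹-involutive; ⁻¹-selfInverse; p≢p⁻¹; p+p⁻¹≡1ℙ; suc-homo-⁻¹; +-homo-+; *-homo-*)
open import Data.Product using (_,_; proj₁)
open import Data.Sum using (_⊎_; inj₁; inj₂; [_,_]; swap)
open import Data.Sum.Properties using (swap-involutive)
open import Data.Unit using (tt)
open import Data.Vec.Functional using (Vector) renaming ([] to []ᵛ; _∷_ to _∷ᵛ_)
open import Effect.Monad using (RawMonad)
open import Function using (_∘_; id; const; Equivalence)
open import Relation.Binary.Definitions using (DecidableEquality)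
open import Relation.Binary.PropositionalEquality using (_≡_; _≢_; refl; sym; trans; cong; subst)
open import Relation.Nullary using (Dec; yes; no; contradiction; _×-dec_; _⊎-dec_)
open import Relation.Nullary.Negation using (¬¬-Monad; ¬¬-map)

parity-suc : ∀ n → parity (suc n) ≡ parity n ⁻¹
parity-suc n = sym (⁻¹-selfInverse (suc-homo-⁻¹ n))

parity-≢-suc : ∀ n → parity n ≢ parity (suc n)
parity-≢-suc n e = p≢p⁻¹ (parity n) (trans e (parity-suc n))

parity-2n+1 : ∀ n → parity (2 * n + 1) ≡ 1ℙ
parity-2n+1 n = trans (+-homo-+ (2 * n) 1) (cong (ℙ._+ 1ℙ) (*-homo-* 2 n))

parity-n+1+n : ∀ n → parity (n + suc n) ≡ 1ℙ
parity-n+1+n n =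
  trans (+-homo-+ n (suc n)) (trans (cong (parity n ℙ.+_) (parity-suc n)) (p+p⁻¹≡1ℙ (parity n)))

≢⇒≡⁻¹ : ∀ {p q : Parity} → p ≢ q → q ≡ p ⁻¹
≢⇒≡⁻¹ {0ℙ} {0ℙ} p≢q = contradiction refl p≢q
≢⇒≡⁻¹ {0ℙ} {1ℙ} _   = refl
≢⇒≡⁻¹ {1ℙ} {0ℙ} _   = refl
≢⇒≡⁻¹ {1ℙ} {1ℙ} p≢q = contradiction refl p≢q

⁻¹-distribˡ-+ : ∀ p q → (p ℙ.+ q) ⁻¹ ≡ p ⁻¹ ℙ.+ q
⁻¹-distribˡ-+ 0ℙ q = refl
⁻¹-distribˡ-+ 1ℙ q = ⁻¹-involutive q

p+[p+q]≡q : ∀ p q → p ℙ.+ (p ℙ.+ q) ≡ q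
p+[p+q]≡q 0ℙ q = refl
p+[p+q]≡q 1ℙ q = ⁻¹-involutive q

p+[p+q]⁻¹≡q⁻¹ : ∀ p q → p ℙ.+ (p ℙ.+ q) ⁻¹ ≡ q ⁻¹
p+[p+q]⁻¹≡q⁻¹ 0ℙ q = refl
p+[p+q]⁻¹≡q⁻¹ 1ℙ q = cong _⁻¹ (⁻¹-involutive q)

-- The rim of a wheel: E (Wheel m h) (suc i) (suc j) unfolds to CycEdge m i j.
CycEdge : (n : ℕ) → Fin n → Fin n → Set
CycEdge n i j = CycAdj n i j ⊎ CycAdj n j i

CycAdj? : ∀ n (i j : Fin n) → Dec (CycAdj n i j)
CycAdj? n i j = (toℕ j ≟ℕ suc (toℕ i)) ⊎-dec ((toℕ i ≟ℕ n ∸ 1) ×-dec (toℕ j ≟ℕ 0))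

predecessor-unique : ∀ {n} {u w t : Fin n} → CycAdj n u t → CycAdj n w t → u ≡ w
predecessor-unique (inj₁ t≡1+u) (inj₁ t≡1+w) = toℕ-injective (suc-injective (trans (sym t≡1+u) t≡1+w))
predecessor-unique (inj₁ t≡1+u) (inj₂ (_ , t≡0)) with () ← trans (sym t≡1+u) t≡0
predecessor-unique (inj₂ (_ , t≡0)) (inj₁ t≡1+w) with () ← trans (sym t≡1+w) t≡0
predecessor-unique (inj₂ (u≡last , _)) (inj₂ (w≡last , _)) = toℕ-injective (trans u≡last (sym w≡last))

private
  beyond-last : ∀ {n} {t : Fin n} (u : Fin n) → toℕ t ≡ n ∸ 1 → toℕ u ≢ suc (toℕ t)
  beyond-last {suc n} u t≡last u≡1+t = <⇒≢ (toℕ<n u) (trans u≡1+t (cong suc t≡last))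

successor-unique : ∀ {n} {t u w : Fin n} → CycAdj n t u → CycAdj n t w → u ≡ w
successor-unique (inj₁ u≡1+t) (inj₁ w≡1+t) = toℕ-injective (trans u≡1+t (sym w≡1+t))
successor-unique (inj₁ u≡1+t) (inj₂ (t≡last , _)) = contradiction u≡1+t (beyond-last _ t≡last)
successor-unique (inj₂ (t≡last , _)) (inj₁ w≡1+t) = contradiction w≡1+t (beyond-last _ t≡last)
successor-unique (inj₂ (_ , u≡0)) (inj₂ (_ , w≡0)) = toℕ-injective (trans u≡0 (sym w≡0))

CycAdj-asym : ∀ {n} → 3 ≤ n → ∀ {u v : Fin n} → CycAdj n u v → ¬ CycAdj n v u
CycAdj-asym _ {u} (inj₁ v≡1+u) (inj₁ u≡1+v) = <⇒≢ (m<n+m (toℕ u) z<s) (trans u≡1+v (cong suc v≡1+u))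
CycAdj-asym (s≤s (s≤s (s≤s _))) (inj₁ v≡1+u) (inj₂ (v≡last , u≡0))
  with () ← trans (sym v≡last) (trans v≡1+u (cong suc u≡0))
CycAdj-asym (s≤s (s≤s (s≤s _))) (inj₂ (u≡last , v≡0)) (inj₁ u≡1+v)
  with () ← trans (sym u≡last) (trans u≡1+v (cong suc v≡0))
CycAdj-asym (s≤s (s≤s (s≤s _))) (inj₂ (u≡last , _)) (inj₂ (_ , u≡0))
  with () ← trans (sym u≡last) u≡0

successor : ∀ {n} (i : Fin n) → Σ (Fin n) (CycAdj n i)
successor {suc n} i with n ≟ℕ toℕ i
... | yes n≡i = zero , inj₂ (sym n≡i , refl)
... | no n≢i  = suc (lower₁ i n≢i) , inj₁ (cong suc (toℕ-lower₁ i n≢i))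

predecessor : ∀ {n} (j : Fin n) → Σ (Fin n) λ i → CycAdj n i j
predecessor {suc n} zero    = fromℕ n , inj₂ (toℕ-fromℕ n , refl)
predecessor {suc n} (suc j) = inject₁ j , inj₁ (cong suc (sym (toℕ-inject₁ j)))

triangle-edge : ∀ {u v : Fin 3} → u ≢ v → CycEdge 3 u v
triangle-edge {zero}           {zero}           u≢v = contradiction refl u≢v
triangle-edge {zero}           {suc zero}       _   = inj₁ (inj₁ refl)
triangle-edge {zero}           {suc (suc zero)} _   = inj₂ (inj₂ (refl , refl))
triangle-edge {suc zero}       {zero}           _   = inj₂ (inj₁ refl)
triangle-edge {suc zero}       {suc zero}       u≢v = contradiction refl u≢v
triangle-edge {suc zero}       {suc (suc zero)} _   = inj₁ (inj₁ refl)
triangle-edge {suc (suc zero)} {zero}           _   = inj₁ (inj₂ (refl , refl))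
triangle-edge {suc (suc zero)} {suc zero}       _   = inj₂ (inj₁ refl)
triangle-edge {suc (suc zero)} {suc (suc zero)} u≢v = contradiction refl u≢v

-- Positions up to u are coloured by their parity and those beyond u by the parity of
-- i + n: consecutive positions differ except across the cut after u, and the shift by n
-- also separates the last position from 0.
cut-colouring : ∀ {n} → Fin n → Fin n → Parity
cut-colouring {n} u i with toℕ i ≤? toℕ u
... | yes _ = parity (toℕ i)
... | no _  = parity (toℕ i + n)

cut-colouring-proper : ∀ {n} {u i j : Fin n} → CycAdj n i j → i ≢ u →
                       cut-colouring u i ≢ cut-colouring u j
cut-colouring-proper {n} {u} {i} {j} (inj₁ j≡1+i) i≢u with toℕ i ≤? toℕ u | toℕ j ≤? toℕ u
... | yes _ | yes _ rewrite j≡1+i = parity-≢-suc (toℕ i)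
... | no _  | no _  rewrite j≡1+i = parity-≢-suc (toℕ i + n)
... | yes i≤u | no j≰u =
  contradiction (subst (_≤ toℕ u) (sym j≡1+i) (≤∧≢⇒< i≤u (i≢u ∘ toℕ-injective))) j≰u
... | no i≰u | yes j≤u = contradiction (≤-trans (n≤1+n _) (subst (_≤ toℕ u) j≡1+i j≤u)) i≰u
cut-colouring-proper {suc n} {u} {i} {j} (inj₂ (i≡last , j≡0)) i≢u
  with toℕ i ≤? toℕ u | toℕ j ≤? toℕ u
... | _ | no j≰u = contradiction (subst (_≤ toℕ u) (sym j≡0) z≤n) j≰u
... | yes i≤u | yes _ = contradiction (toℕ-injective (≤-antisym i≤u u≤i)) i≢u
  where u≤i = subst (toℕ u ≤_) (sym i≡last) (≤-pred (toℕ<n u))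
... | no _ | yes _ rewrite i≡last | j≡0 = λ e → contradiction (trans (sym (parity-n+1+n n)) e) λ ()

parity-flips-around-odd-cycle : ∀ {n} → parity n ≡ 1ℙ → (Q : Fin n → Parity → Set) →
  (∀ {i j p} → CycAdj n i j → Q i p → Q j (p ⁻¹)) → ∀ {i p} → Q i p → Q i (p ⁻¹)
parity-flips-around-odd-cycle {suc m} odd Q flip {i} {p} =
  from-Q° ∘ climb z≤n ∘ flip wrap ∘ at-last ∘ climb (≤fromℕ i) ∘ to-Q°
  where
  -- Measured against the parity of the position, Q° c is invariant along every edge
  -- except the wrap-around one, which (m being even) turns Q° c into Q° (c ⁻¹).
  Q° : Parity → Fin (suc m) → Set
  Q° c i = Q i (parity (toℕ i) ℙ.+ c)

  climb : ∀ {c i j} → i ≤ᶠ j → Q° c i → Q° c j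
  climb {c} i≤j q = <-weakInduction-startingFrom (Q° c) q step i≤j
    where
    step : ∀ k → Q° c (inject₁ k) → Q° c (suc k)
    step k = subst (Q (suc k)) shift ∘ flip (inj₁ (cong suc (sym (toℕ-inject₁ k))))
      where
      shift : (parity (toℕ (inject₁ k)) ℙ.+ c) ⁻¹ ≡ parity (suc (toℕ k)) ℙ.+ c
      shift = trans (cong (λ t → (parity t ℙ.+ c) ⁻¹) (toℕ-inject₁ k))
                (trans (⁻¹-distribˡ-+ (parity (toℕ k)) c) (cong (ℙ._+ c) (sym (parity-suc (toℕ k)))))

  c = parity (toℕ i) ℙ.+ p

  to-Q° : Q i p → Q° c i
  to-Q° = subst (Q i) (sym (p+[p+q]≡q (parity (toℕ i)) p))

  at-last : Q° c (fromℕ m) → Q (fromℕ m) c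
  at-last = subst (Q (fromℕ m)) (cong (ℙ._+ c) even)
    where
    even : parity (toℕ (fromℕ m)) ≡ 0ℙ
    even = trans (cong parity (toℕ-fromℕ m)) (trans (sym (suc-homo-⁻¹ m)) (cong _⁻¹ odd))

  wrap : CycAdj (suc m) (fromℕ m) zero
  wrap = inj₂ (toℕ-fromℕ m , refl)

  from-Q° : Q° (c ⁻¹) i → Q i (p ⁻¹)
  from-Q° = subst (Q i) (p+[p+q]⁻¹≡q⁻¹ (parity (toℕ i)) p)

record OddCycleLink {V : Set} (R : V → V → Set) (v : V) : Set where
  field
    len           : ℕ
    3≤len         : 3 ≤ len
    odd           : parity len ≡ 1ℙ
    pos           : V → Fin len
    pos-injective : ∀ {x y} → R v x → R v y → pos x ≡ pos y → x ≡ y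
    pos-edge      : ∀ {x y} → R v x → R v y → R x y → CycEdge len (pos x) (pos y)

LinksInOddCycles : Graph → Set
LinksInOddCycles G = ∀ v → OddCycleLink (E G) v

OddCycleLink-pullback : ∀ {V W : Set} {R : V → V → Set} {S : W → W → Set} (f : W → V) →
  (∀ {x y} → f x ≡ f y → x ≡ y) → (∀ {x y} → S x y → R (f x) (f y)) →
  ∀ {v} → OddCycleLink R (f v) → OddCycleLink S v
OddCycleLink-pullback f f-injective f-hom L = record
  { len           = len
  ; 3≤len         = 3≤len
  ; odd           = odd
  ; pos           = pos ∘ f
  ; pos-injective = λ vx vy → f-injective ∘ pos-injective (f-hom vx) (f-hom vy)
  ; pos-edge      = λ vx vy → pos-edge (f-hom vx) (f-hom vy) ∘ f-hom
  }
  where open OddCycleLink L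

sub-links : ∀ {G H} → Sub G H → LinksInOddCycles H → LinksInOddCycles G
sub-links (f , f-injective , f-hom) LH v = OddCycleLink-pullback f f-injective (f-hom _ _) (LH (f v))

module _ {m n} {R : Fin m → Fin m → Set} {S : Fin n → Fin n → Set} where

  UE-linkˡ : ∀ {a} → OddCycleLink R a → OddCycleLink (UE R S) (inj₁ a)
  UE-linkˡ {a} L = record
    { len           = len
    ; 3≤len         = 3≤len
    ; odd           = odd
    ; pos           = pos⁺
    ; pos-injective = λ {x} {y} → pos⁺-injective {x} {y}
    ; pos-edge      = λ {x} {y} → pos⁺-edge {x} {y}
    }
    where
    open OddCycleLink L
    pos⁺ : Fin m ⊎ Fin n → Fin len
    pos⁺ = [ pos , const (pos a) ]
    pos⁺-injective : ∀ {x y} → UE R S (inj₁ a) x → UE R S (inj₁ a) y → pos⁺ x ≡ pos⁺ y → x ≡ y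
    pos⁺-injective {inj₁ _} {inj₁ _} ax ay = cong inj₁ ∘ pos-injective ax ay
    pos⁺-edge : ∀ {x y} → UE R S (inj₁ a) x → UE R S (inj₁ a) y → UE R S x y →
                CycEdge len (pos⁺ x) (pos⁺ y)
    pos⁺-edge {inj₁ _} {inj₁ _} = pos-edge

UE-swap : ∀ {m n} {R : Fin m → Fin m → Set} {S : Fin n → Fin n → Set} {x y} →
          UE R S x y → UE S R (swap x) (swap y)
UE-swap {x = inj₁ _} {inj₁ _} xy = xy
UE-swap {x = inj₂ _} {inj₂ _} xy = xy

UE-linkʳ : ∀ {m n} {R : Fin m → Fin m → Set} {S : Fin n → Fin n → Set} {b} →
           OddCycleLink S b → OddCycleLink (UE R S) (inj₂ b)
UE-linkʳ {R = R} {S} L =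
  OddCycleLink-pullback swap swap-injective (λ {x} {y} → UE-swap {R = R} {S} {x} {y}) (UE-linkˡ L)
  where
  swap-injective : ∀ {x y} → swap x ≡ swap y → x ≡ y
  swap-injective {x} {y} e = trans (sym (swap-involutive x)) (trans (cong swap e) (swap-involutive y))

⊕-links : ∀ {G H} → LinksInOddCycles G → LinksInOddCycles H → LinksInOddCycles (G ⊕ H)
⊕-links {G} {H} LG LH v =
  OddCycleLink-pullback (splitAt (size G)) splitAt-injective id (UE-links (splitAt (size G) v))
  where
  splitAt-injective : ∀ {x y} → splitAt (size G) x ≡ splitAt (size G) y → x ≡ y
  splitAt-injective {x} {y} e =
    trans (sym (join-splitAt _ (size H) x)) (trans (cong (join _ _) e) (join-splitAt _ (size H) y))
  UE-links : ∀ s → OddCycleLink (UE (E G) (E H)) s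
  UE-links (inj₁ a) = UE-linkˡ (LG a)
  UE-links (inj₂ b) = UE-linkʳ (LH b)

3≤2n+1 : ∀ {n} → 1 ≤ n → 3 ≤ 2 * n + 1
3≤2n+1 h = +-monoˡ-≤ 1 (*-monoʳ-≤ 2 h)

module _ (m : ℕ) (3≤m : 3 ≤ m) where
  private
    W : Graph
    W = Wheel m 3≤m

  apex-link : parity m ≡ 1ℙ → OddCycleLink (E W) zero
  apex-link odd = record
    { len           = m
    ; 3≤len         = 3≤m
    ; odd           = odd
    ; pos           = pos
    ; pos-injective = λ {x} {y} → injective {x} {y}
    ; pos-edge      = λ {x} {y} → edge-preserving {x} {y}
    }
    where
    pos : Fin (suc m) → Fin m
    pos zero    = fromℕ< 3≤m   -- arbitrary: the apex is not in its own link
    pos (suc j) = j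
    injective : ∀ {x y} → E W zero x → E W zero y → pos x ≡ pos y → x ≡ y
    injective {suc _} {suc _} _ _ = cong suc
    edge-preserving : ∀ {x y} → E W zero x → E W zero y → E W x y → CycEdge m (pos x) (pos y)
    edge-preserving {suc _} {suc _} _ _ = id

  -- The link of a rim vertex i is the apex and the two rim neighbours of i,
  -- sent to the middle and the two ends of a triangle.
  rim-link : ∀ i → OddCycleLink (E W) (suc i)
  rim-link i = record
    { len           = 3
    ; 3≤len         = ≤-refl
    ; odd           = refl
    ; pos           = pos
    ; pos-injective = λ {x} {y} → injective {x} {y}
    ; pos-edge      = λ {x} {y} ix iy xy →
                        triangle-edge λ e → irref W x (subst (E W x) (sym (injective ix iy e)) xy)
    }
    where
    side : ∀ {j} → Dec (CycAdj m j i) → Fin 3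
    side (yes _) = zero
    side (no _)  = suc (suc zero)
    side-≢-middle : ∀ {j} (d : Dec (CycAdj m j i)) → side d ≢ suc zero
    side-≢-middle (yes _) ()
    side-≢-middle (no _)  ()
    pos : Fin (suc m) → Fin 3
    pos zero    = suc zero
    pos (suc j) = side (CycAdj? m j i)
    forward : ∀ {j} → CycEdge m i j → ¬ CycAdj m j i → CycAdj m i j
    forward (inj₁ i→j) _   = i→j
    forward (inj₂ j→i) j↛i = contradiction j→i j↛i
    injective : ∀ {x y} → E W (suc i) x → E W (suc i) y → pos x ≡ pos y → x ≡ y
    injective {zero}  {zero}  _ _ _ = refl
    injective {zero}  {suc k} _ _ e = contradiction (sym e) (side-≢-middle _)
    injective {suc j} {zero}  _ _ e = contradiction e (side-≢-middle _)
    injective {suc j} {suc k} ij ik e with CycAdj? m j i | CycAdj? m k i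
    injective {suc j} {suc k} _  _  _  | yes j→i | yes k→i = cong suc (predecessor-unique j→i k→i)
    injective {suc j} {suc k} ij ik _  | no j↛i  | no k↛i  =
      cong suc (successor-unique (forward ij j↛i) (forward ik k↛i))
    injective {suc j} {suc k} _  _  () | yes _   | no _
    injective {suc j} {suc k} _  _  () | no _    | yes _

  wheel-links : parity m ≡ 1ℙ → LinksInOddCycles W
  wheel-links odd zero    = apex-link odd
  wheel-links odd (suc i) = rim-link i

InC⇒links : ∀ {G} → InC G → LinksInOddCycles G
InC⇒links (wheel N h)           = wheel-links (2 * N + 1) (3≤2n+1 h) (parity-2n+1 N)
InC⇒links (sub {G} {H} cH s)    = sub-links {G} {H} s (InC⇒links cH)
InC⇒links (union {G} {H} cG cH) = ⊕-links {G} {H} (InC⇒links cG) (InC⇒links cH)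

Colouring : Graph → Set → Set
Colouring G C = Σ (Fin (size G) → C) λ c → ∀ {x y} → E G x y → c x ≢ c y

LinkColouring : (G : Graph) → Fin (size G) → Set → Set
LinkColouring G a C = Σ (Fin (size G) → C) λ c → ∀ {x y} → E G a x → E G a y → E G x y → c x ≢ c y

LinkColouring-pullback : ∀ {A B C} (h : Hom A B) {a} → LinkColouring B (proj₁ h a) C → LinkColouring A a C
LinkColouring-pullback (f , f-hom) (c , proper) =
  c ∘ f , λ ax ay xy → proper (f-hom _ _ ax) (f-hom _ _ ay) (f-hom _ _ xy)

-- The colour of a is missing from its link, which leaves two colours there.
link-colouring : ∀ {G} → Colouring G (Maybe Parity) → ∀ a → LinkColouring G a Parity
link-colouring (c , proper) a =
  (λ x → relative (c a) (c x)) , λ ax ay xy → relative-injective (proper ax) (proper ay) (proper xy)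
  where
  relative : Maybe Parity → Maybe Parity → Parity
  relative nothing  (just p) = p
  relative nothing  nothing  = 0ℙ
  relative (just _) nothing  = 0ℙ
  relative (just _) (just _) = 1ℙ
  relative-injective : ∀ {k c d} → k ≢ c → k ≢ d → c ≢ d → relative k c ≢ relative k d
  relative-injective {nothing} {nothing}         k≢c _   _   = contradiction refl k≢c
  relative-injective {nothing} {just _} {nothing} _   k≢d _   = contradiction refl k≢d
  relative-injective {nothing} {just _} {just _}  _   _   c≢d = c≢d ∘ cong just
  relative-injective {just _}  {nothing} {nothing} _  _   c≢d = contradiction refl c≢d
  relative-injective {just _}  {nothing} {just _}  _  _   _   = λ ()
  relative-injective {just _}  {just _} {nothing}  _  _   _   = λ ()
  relative-injective {just _}  {just _} {just _}   k≢c k≢d c≢d _ =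
    c≢d (cong just (trans (≢⇒≡⁻¹ (k≢c ∘ cong just)) (sym (≢⇒≡⁻¹ (k≢d ∘ cong just)))))

TwoCommonNeighbours : (G : Graph) → Fin (size G) → Fin (size G) → Set
TwoCommonNeighbours G a x =
  Σ (Fin (size G)) λ y → Σ (Fin (size G)) λ z → z ≢ y × E G a y × E G a z × E G x y × E G x z

Hub : (G : Graph) → Fin (size G) → Set
Hub G a = Σ (Fin (size G)) (E G a) × (∀ x → ¬ (E G a x × ¬ TwoCommonNeighbours G a x))

-- hasHub is  ∃a. (∃x. a ~ x) ∧ ∀x. ¬ (a ~ x ∧ ¬ ∃y z. z ≠ y ∧ a ~ y ∧ a ~ z ∧ x ~ y ∧ x ~ z),
-- so that  G ⊨ hasHub  is by definition  Σ a (Hub G a).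
hasHub : Sentence
hasHub = ex (and (ex (edge (# 1) (# 0))) (all (not (and (edge (# 1) (# 0)) (not commonNeighbours)))))
  where
  commonNeighbours : Fm 2
  commonNeighbours = ex (ex (and (not (eq (# 0) (# 1)))
    (and (edge (# 3) (# 1)) (and (edge (# 3) (# 0)) (and (edge (# 2) (# 1)) (edge (# 2) (# 0)))))))

wheel-hub : ∀ m (h : 3 ≤ m) → Hub (Wheel m h) zero
wheel-hub m h = (suc (fromℕ< h) , tt) , λ where
    zero    (() , _)
    (suc j) (_ , ¬common) → ¬common (common j)
  where
  common : ∀ j → TwoCommonNeighbours (Wheel m h) zero (suc j)
  common j with predecessor j | successor j
  ... | p , p→j | s , j→s =
    suc p , suc s , s≢p , tt , tt , inj₂ p→j , inj₁ j→s
    where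
    s≢p : suc s ≢ suc p
    s≢p s≡p = CycAdj-asym h j→s (subst (λ k → CycAdj m k j) (sym (sucᶠ-injective s≡p)) p→j)

oddWheel⊨hasHub : ∀ N h → oddWheel N h ⊨ hasHub
oddWheel⊨hasHub N h = zero , wheel-hub (2 * N + 1) (3≤2n+1 h)

module _ {G : Graph} {a : Fin (size G)} (L : OddCycleLink (E G) a) where
  open OddCycleLink L

  successor-in-link : ∀ {x} → E G a x → TwoCommonNeighbours G a x →
    Σ (Fin (size G)) λ x' → E G a x' × E G x x' × CycAdj len (pos x) (pos x')
  successor-in-link ax (y , z , z≢y , ay , az , xy , xz) with pos-edge ax ay xy | pos-edge ax az xz
  ... | inj₁ x→y | _        = y , ay , xy , x→y
  ... | inj₂ _   | inj₁ x→z = z , az , xz , x→z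
  ... | inj₂ y→x | inj₂ z→x = contradiction (pos-injective az ay (predecessor-unique z→x y→x)) z≢y

  -- Walking once around the odd cycle through successors inside the link
  -- flips the colour an odd number of times.
  hub-link-not-2-colourable : Hub G a → ¬ LinkColouring G a Parity
  hub-link-not-2-colourable ((x₀ , ax₀) , hub) (col , proper) =
    parity-flips-around-odd-cycle odd Q flip (pure (x₀ , ax₀ , refl , refl))
      λ (x , ax , x₀≈x , col-x) →
        p≢p⁻¹ (col x₀) (trans (cong col (pos-injective ax₀ ax (sym x₀≈x))) col-x)
    where
    open RawMonad ¬¬-Monad
    Q : Fin len → Parity → Set
    Q i p = ¬ ¬ (Σ (Fin (size G)) λ x → E G a x × pos x ≡ i × col x ≡ p)
    flip : ∀ {i j p} → CycAdj len i j → Q i p → Q j (p ⁻¹)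
    flip i→j q = do
      (x , ax , x≈i , col-x) ← q
      (x' , ax' , xx' , x→x') ← ¬¬-map (successor-in-link ax) (λ ¬common → hub x (ax , ¬common))
      pure (x' , ax' , successor-unique (subst (λ k → CycAdj len k (pos x')) x≈i x→x') i→j ,
            trans (≢⇒≡⁻¹ (proper ax ax' xx')) (cong _⁻¹ col-x))

  cut-link-colouring : (u : Fin len) →
    (∀ {y z} → E G a y → E G a z → E G y z → CycAdj len (pos y) (pos z) → pos y ≢ u) →
    LinkColouring G a Parity
  cut-link-colouring u avoids-u = cut-colouring u ∘ pos , proper
    where
    proper : ∀ {y z} → E G a y → E G a z → E G y z → cut-colouring u (pos y) ≢ cut-colouring u (pos z)
    proper ay az yz with pos-edge ay az yz
    ... | inj₁ y→z = cut-colouring-proper y→z (avoids-u ay az yz y→z)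
    ... | inj₂ z→y = cut-colouring-proper z→y (avoids-u az ay (esym G _ _ yz) z→y) ∘ sym

  -- If x has no link neighbour at the successor of pos x, cutting the cycle
  -- after pos x 2-colours the link; symmetrically for the predecessor.
  ¬common⇒¬¬link-2-colourable : ∀ {x} → E G a x → ¬ TwoCommonNeighbours G a x →
                                ¬ ¬ LinkColouring G a Parity
  ¬common⇒¬¬link-2-colourable {x} ax ¬common ¬colouring =
    ¬colouring (cut-after-x λ s → ¬colouring (cut-before-x λ p → ¬common (common s p)))
    where
    Succ Pred : Set
    Succ = Σ (Fin (size G)) λ y → E G a y × E G x y × CycAdj len (pos x) (pos y)
    Pred = Σ (Fin (size G)) λ y → E G a y × E G x y × CycAdj len (pos y) (pos x)

    common : Succ → Pred → TwoCommonNeighbours G a x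
    common (y , ay , xy , x→y) (z , az , xz , z→x) = y , z , z≢y , ay , az , xy , xz
      where
      z≢y : z ≢ y
      z≢y z≡y = CycAdj-asym 3≤len x→y (subst (λ w → CycAdj len (pos w) (pos x)) z≡y z→x)

    cut-after-x : ¬ Succ → LinkColouring G a Parity
    cut-after-x ¬succ = cut-link-colouring (pos x) λ {y} {z} ay az yz y→z y≈x →
      ¬succ (z , az , subst (λ w → E G w z) (pos-injective ay ax y≈x) yz ,
             subst (λ k → CycAdj len k (pos z)) y≈x y→z)

    cut-before-x : ¬ Pred → LinkColouring G a Parity
    cut-before-x ¬pred with predecessor (pos x)
    ... | u , u→x = cut-link-colouring u λ {y} {z} ay az yz y→z y≈u →
      let z≈x = successor-unique (subst (λ k → CycAdj len k (pos z)) y≈u y→z) u→x in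
      ¬pred (y , ay , esym G _ _ (subst (E G y) (pos-injective az ax z≈x) yz) ,
             subst (CycAdj len (pos y)) z≈x y→z)

hasHub-preserved : PreservedOver InC hasHub
hasHub-preserved A B cA cB h@(f , f-hom) (a , (x₀ , ax₀) , hubA) =
  f a , (f x₀ , f-hom a x₀ ax₀) , λ x (bx , ¬common) →
    ¬common⇒¬¬link-2-colourable {B} (InC⇒links cB (f a)) bx ¬common λ colouring →
      hub-link-not-2-colourable {A} (InC⇒links cA a) ((x₀ , ax₀) , hubA)
        (LinkColouring-pullback {A} {B} h colouring)

#∃ : ∀ {k} {ψ : Fm k} → ExPos ψ → ℕ
#∃ true       = 0
#∃ false      = 0
#∃ (edge _ _) = 0
#∃ (eq _ _)   = 0
#∃ (and p q)  = #∃ p + #∃ q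
#∃ (or p q)   = #∃ p + #∃ q
#∃ (ex p)     = suc (#∃ p)

restrictEdges : (G : Graph) → (Fin (size G) → Set) → Graph
restrictEdges G S = record
  { size  = size G
  ; E     = λ x y → E G x y × S x × S y
  ; esym  = λ { x y (xy , Sx , Sy) → esym G x y xy , Sy , Sx }
  ; irref = λ x → irref G x ∘ proj₁
  }

restrictEdges-sub : ∀ G S → Sub (restrictEdges G S) G
restrictEdges-sub G S = id , id , λ _ _ → proj₁

-- A satisfying assignment of an existential-positive formula only looks at
-- the edges between the free variables and at most #∃ witnesses.
ExPos-local : ∀ {k} {ψ : Fm k} (ep : ExPos ψ) (G : Graph) (ρ : Vector (Fin (size G)) k) → Sat G ψ ρ →
  Σ (List (Fin (size G))) λ L → length L ≤ #∃ ep ×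
    ((S : Fin (size G) → Set) → (∀ i → S (ρ i)) → (∀ {x} → x ∈ L → S x) → Sat (restrictEdges G S) ψ ρ)
ExPos-local true       G ρ _  = [] , z≤n , λ _ _ _ → tt
ExPos-local (edge i j) G ρ xy = [] , z≤n , λ _ Sρ _ → xy , Sρ i , Sρ j
ExPos-local (eq i j)   G ρ e  = [] , z≤n , λ _ _ _ → e
ExPos-local (and p q)  G ρ (s , t) with ExPos-local p G ρ s | ExPos-local q G ρ t
... | L₁ , |L₁|≤ , local₁ | L₂ , |L₂|≤ , local₂ =
  L₁ ++ L₂ , subst (_≤ #∃ p + #∃ q) (sym (length-++ L₁)) (+-mono-≤ |L₁|≤ |L₂|≤) ,
  λ S Sρ SL → local₁ S Sρ (SL ∘ ∈-++⁺ˡ) , local₂ S Sρ (SL ∘ ∈-++⁺ʳ L₁)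
ExPos-local (or p q)   G ρ (inj₁ s) with ExPos-local p G ρ s
... | L , |L|≤ , local = L , ≤-trans |L|≤ (m≤m+n _ _) , λ S Sρ SL → inj₁ (local S Sρ SL)
ExPos-local (or p q)   G ρ (inj₂ t) with ExPos-local q G ρ t
... | L , |L|≤ , local = L , ≤-trans |L|≤ (m≤n+m _ _) , λ S Sρ SL → inj₂ (local S Sρ SL)
ExPos-local (ex p)     G ρ (v , s) with ExPos-local p G (v ∷ᵛ ρ) s
... | L , |L|≤ , local = v ∷ L , s≤s |L|≤ , λ S Sρ SL →
  v , local S (λ { zero → SL (here refl) ; (suc i) → Sρ i }) (SL ∘ there)

missing-from-short-list : ∀ {A : Set} {m} → DecidableEquality A → (f : Fin m → A) →
  (∀ {i j} → f i ≡ f j → i ≡ j) → (L : List A) → length L < m → Σ (Fin m) λ i → f i ∉ L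
missing-from-short-list _≟_ f f-injective L |L|<m =
  ¬∀⟶∃¬ _ (λ i → f i ∈ L) (λ i → member? _≟_ (f i) L) all-in
  where
  all-in : ¬ (∀ i → f i ∈ L)
  all-in f∈L with i , j , i<j , same-index ← pigeonhole |L|<m (index ∘ f∈L) =
    <ᶠ⇒≢ i<j (f-injective (trans (lookup-index (f∈L i))
                                 (trans (cong (lookup L) same-index) (sym (lookup-index (f∈L j))))))

module _ (m : ℕ) (3≤m : 3 ≤ m) (r : Fin m) where

  wheel-minus : Graph
  wheel-minus = restrictEdges (Wheel m 3≤m) (_≢ suc r)

  wheel-minus-colouring : Colouring wheel-minus (Maybe Parity)
  wheel-minus-colouring = c , proper
    where
    c : Fin (suc m) → Maybe Parity
    c zero    = nothing
    c (suc v) = just (cut-colouring r v)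
    proper : ∀ {x y} → E wheel-minus x y → c x ≢ c y
    proper {zero}  {zero}  (() , _)
    proper {zero}  {suc _} _ = λ ()
    proper {suc _} {zero}  _ = λ ()
    proper {suc _} {suc _} (inj₁ u→v , u≢r , _) =
      cut-colouring-proper u→v (u≢r ∘ cong suc) ∘ just-injective
    proper {suc _} {suc _} (inj₂ v→u , _ , v≢r) =
      cut-colouring-proper v→u (v≢r ∘ cong suc) ∘ sym ∘ just-injective

ExPos-true-in-wheel-minus : ∀ {ψ} (ep : ExPos ψ) m (h : 3 ≤ m) → #∃ ep < m →
  Wheel m h ⊨ ψ → Σ (Fin m) λ r → wheel-minus m h r ⊨ ψ
ExPos-true-in-wheel-minus ep m h bound W⊨ψ
  with L , |L|≤ , local ← ExPos-local ep (Wheel m h) []ᵛ W⊨ψ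
  with r , r∉L ← missing-from-short-list _≟ᶠ_ suc sucᶠ-injective L (≤-<-trans |L|≤ bound) =
  r , local (_≢ suc r) (λ ()) (λ x∈L x≡r → r∉L (subst (_∈ L) x≡r x∈L))

3-colourable⊭hasHub : ∀ {G} → InC G → Colouring G (Maybe Parity) → ¬ (G ⊨ hasHub)
3-colourable⊭hasHub {G} cG c (a , hub) =
  hub-link-not-2-colourable {G} (InC⇒links cG a) hub (link-colouring {G} c a)

hasHub-not-ExPos : ¬ (Σ Sentence λ ψ → ExPos ψ × EquivOver InC hasHub ψ)
hasHub-not-ExPos (ψ , ep , hasHub⇔ψ) = wheel-minus-⊭ψ (ExPos-true-in-wheel-minus ep m h bound W⊨ψ)
  where
  N = suc (#∃ ep)
  N≥1 : 1 ≤ N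
  N≥1 = s≤s z≤n
  m = 2 * N + 1
  h = 3≤2n+1 N≥1
  bound : #∃ ep < m
  bound = s≤s (≤-trans (m≤m+n _ _) (m≤m+n _ 1))
  W⊨ψ : oddWheel N N≥1 ⊨ ψ
  W⊨ψ = Equivalence.to (hasHub⇔ψ _ (wheel N N≥1)) (oddWheel⊨hasHub N N≥1)
  wheel-minus-⊭ψ : ¬ (Σ (Fin m) λ r → wheel-minus m h r ⊨ ψ)
  wheel-minus-⊭ψ (r , W⁻⊨ψ) =
    3-colourable⊭hasHub W⁻∈C (wheel-minus-colouring m h r) (Equivalence.from (hasHub⇔ψ _ W⁻∈C) W⁻⊨ψ)
    where
    W⁻∈C : InC (wheel-minus m h r)
    W⁻∈C = sub (wheel N N≥1) (restrictEdges-sub (oddWheel N N≥1) _)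

theorem3p4 : Σ Sentence λ φ → PreservedOver InC φ × ¬ (Σ Sentence λ ψ → ExPos ψ × EquivOver InC φ ψ)
theorem3p4 = hasHub , hasHub-preserved , hasHub-not-ExPos
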